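{- Let $\mathcal R$ range over $\{\equiv,=_\beta,=_{\beta\eta}\}$ and $\mathcal T$ over $\{\mathcal T_{\rm CD},\mathcal T_{\rm CDS},\mathcal T_{\rm CDV},\mathcal T_{\rm BCD}\}$. (1) For every $\mathcal R$: $\Delta^{\rm CD}_{\mathcal R}\sqsubseteq\Delta^{\rm CDS}_{\mathcal R}\sqsubseteq\Delta^{\rm BCD}_{\mathcal R}$ and $\Delta^{\rm CD}_{\mathcal R}\sqsubseteq\Delta^{\rm CDV}_{\mathcal R}\sqsubseteq\Delta^{\rm BCD}_{\mathcal R}$. (2) If $\mathcal T_1\sqsubseteq\mathcal T_2$ and $\mathcal R_1\sqsubseteq\mathcal R_2$, then $\Delta^{\mathcal T_1}_{\mathcal R_1}\sqsubseteq\Delta^{\mathcal T_2}_{\mathcal R_2}$.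
   Context: Types: let $\mathbb A_\infty=\{a_i\mid i\in\mathbb N\}$ be type atoms, $\omega$ a special atom, $\mathbb A^\omega_\infty=\mathbb A_\infty\cup\{\omega\}$. Over an atom set $\mathbb A$, types are $\sigma::=\mathbb A\mid\sigma\to\sigma\mid\sigma\cap\sigma$. The minimal type theory consists of: (refl) $\sigma\le\sigma$; (incl) $\sigma\cap\tau\le\sigma$, $\sigma\cap\tau\le\tau$; (glb) $\rho\le\sigma,\rho\le\tau\Rightarrow\rho\le\sigma\cap\tau$; (trans) $\sigma\le\tau,\tau\le\rho\Rightarrow\sigma\le\rho$. Extra axioms/rules: $(\omega_{top})$ $\sigma\le\omega$; $(\omega_\to)$ $\omega\le\sigma\to\omega$; $(\to\cap)$ $(\sigma\to\tau)\cap(\sigma\to\rho)\le\sigma\to(\tau\cap\rho)$; $(\to)$ $\sigma_2\le\sigma_1,\tau_1\le\tau_2\Rightarrow\sigma_1\to\tau_1\le\sigma_2\to\tau_2$. $\mathcal T_{\rm CD}$: smallest theory over $\mathbb A_\infty$ closed under the minimal rules; $\mathcal T_{\rm CDS}$: over $\mathbb A^\omega_\infty$, plus $(\omega_{top})$; $\mathcal T_{\rm CDV}$: over $\mathbb A_\infty$, plus $(\to),(\to\cap)$; $\mathcal T_{\rm BCD}$: over $\mathbb A^\omega_\infty$, plus $(\to),(\to\cap),(\omega_{top}),(\omega_\to)$. Write $\sigma\le_{\mathcal T}\tau$ for membership; $\mathcal T_1\sqsubseteq\mathcal T_2$ means $\sigma\le_{\mathcal T_1}\tau$ implies $\sigma\le_{\mathcal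 T_2}\tau$. $\Delta$-terms: $\Delta::=u_\Delta\mid x\mid\lambda x{:}\sigma.\Delta\mid\Delta\,\Delta\mid\langle\Delta,\Delta\rangle\mid pr_i\Delta\mid\Delta^\sigma$ ($i\in\{1,2\}$), where $u_\Delta$ is a constant indexed by an arbitrary (not necessarily typable) $\Delta$-term and $\Delta^\sigma$ is an explicit coercion. The essence $\lfloor\Delta\rfloor$ is the pure $\lambda$-term: $\lfloor x\rfloor=x$, $\lfloor u_\Delta\rfloor=\lfloor\Delta\rfloor$, $\lfloor\Delta^\sigma\rfloor=\lfloor\Delta\rfloor$, $\lfloor\lambda x{:}\sigma.\Delta\rfloor=\lambda x.\lfloor\Delta\rfloor$, $\lfloor\Delta_1\Delta_2\rfloor=\lfloor\Delta_1\rfloor\lfloor\Delta_2\rfloor$, $\lfloor\langle\Delta_1,\Delta_2\rangle\rfloor=\lfloor\Delta_1\rfloor$, $\lfloor pr_i\Delta\rfloor=\lfloor\Delta\rfloor$. $\mathcal R\in\{\equiv,=_\beta,=_{\beta\eta}\}$ is an equivalence on pure $\lambda$-terms ($\equiv$ syntactic identity); $\mathcal R_1\sqsubseteq\mathcal R_2$ means $M\mathcal R_1N$ implies $M\mathcal R_2N$. Typed system $\Delta^{\mathcal T}_{\mathcal R}$ (judgments $B\vdash^{\mathcal T}_{\mathcal R}\Delta:\sigma$, $B$ a basis of declarations $x{:}\sigma$, $\mathbb A$ the atom set of $\mathcal T$): (top) $B\vdash u_\Delta:\omega$ if $\omega\in\mathbb A$; (ax) $B\vdash x:\sigma$ if $x{:}\sigma\in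 B$; ($\to I$) from $B,x{:}\sigma\vdash\Delta:\tau$ infer $B\vdash\lambda x{:}\sigma.\Delta:\sigma\to\tau$; ($\to E$) from $B\vdash\Delta_1:\sigma\to\tau$ and $B\vdash\Delta_2:\sigma$ infer $B\vdash\Delta_1\Delta_2:\tau$; ($\cap I$) from $B\vdash\Delta_1:\sigma$, $B\vdash\Delta_2:\tau$ and $\lfloor\Delta_1\rfloor\mathcal R\lfloor\Delta_2\rfloor$ infer $B\vdash\langle\Delta_1,\Delta_2\rangle:\sigma\cap\tau$; ($\cap E_1$/$\cap E_2$) from $B\vdash\Delta:\sigma\cap\tau$ infer $B\vdash pr_1\Delta:\sigma$, resp. $B\vdash pr_2\Delta:\tau$; ($\le_{\mathcal T}$) from $B\vdash\Delta:\sigma$ and $\sigma\le_{\mathcal T}\tau$ infer $B\vdash\Delta^\tau:\tau$. We write $\Delta^{\rm CD}_{\mathcal R}$ for $\Delta^{\mathcal T_{\rm CD}}_{\mathcal R}$ etc. $\Delta^{\mathcal T_1}_{\mathcal R_1}\sqsubseteq\Delta^{\mathcal T_2}_{\mathcal R_2}$ means every judgment $B\vdash^{\mathcal T_1}_{\mathcal R_1}\Delta:\sigma$ derivable in the first system is derivable as $B\vdash^{\mathcal T_2}_{\mathcal R_2}\Delta:\sigma$ in the second. -}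

module Defs where

open import Data.Nat using (ℕ; zero; suc)
open import Data.List using (List; []; _∷_)
open import Data.List.Relation.Unary.All using (All)
open import Data.Unit using (⊤)
open import Data.Product using (_×_)
open import Relation.Binary.PropositionalEquality using (_≡_)

-- Intersection types over the atoms  a_i (i ∈ ℕ)  and  ω.
-- A type theory over 𝔸∞ only uses types with no occurrence of ω.

data Type : Set where
  atom : ℕ → Type
  ω    : Type
  _⇒_  : Type → Type → Type
  _∩_  : Type → Type → Type

infixr 6 _⇒_
infixl 7 _∩_

data NoΩ : Type → Set where
  atom : ∀ i → NoΩ (atom i)
  _⇒_  : ∀ {σ τ} → NoΩ σ → NoΩ τ → NoΩ (σ ⇒ τ)
  _∩_  : ∀ {σ τ} → NoΩ σ → NoΩ τ → NoΩ (σ ∩ τ)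

data Theory : Set where
  CD CDS CDV BCD : Theory

-- ω belongs to the atom set of the theory (atom set 𝔸^ω∞)
data HasΩ : Theory → Set where
  cds : HasΩ CDS
  bcd : HasΩ BCD

Over : Theory → Type → Set
Over CD  σ = NoΩ σ
Over CDS σ = ⊤
Over CDV σ = NoΩ σ
Over BCD σ = ⊤

data HasArr : Theory → Set where
  cdv : HasArr CDV
  bcd : HasArr BCD

HasTop : Theory → Set
HasTop = HasΩ

data HasΩArr : Theory → Set where
  bcd : HasΩArr BCD

data _≤[_]_ : Type → Theory → Type → Set where
  refl  : ∀ {T σ} → Over T σ → σ ≤[ T ] σ
  incl₁ : ∀ {T σ τ} → Over T σ → Over T τ → (σ ∩ τ) ≤[ T ] σ
  incl₂ : ∀ {T σ τ} → Over T σ → Over T τ → (σ ∩ τ) ≤[ T ] τ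
  glb   : ∀ {T ρ σ τ} → ρ ≤[ T ] σ → ρ ≤[ T ] τ → ρ ≤[ T ] (σ ∩ τ)
  trans : ∀ {T σ τ ρ} → σ ≤[ T ] τ → τ ≤[ T ] ρ → σ ≤[ T ] ρ
  ω-top : ∀ {T σ} → HasTop T → Over T σ → σ ≤[ T ] ω
  ω-→   : ∀ {T σ} → HasΩArr T → Over T σ → ω ≤[ T ] (σ ⇒ ω)
  →∩    : ∀ {T σ τ ρ} → HasArr T → Over T σ → Over T τ → Over T ρ →
          ((σ ⇒ τ) ∩ (σ ⇒ ρ)) ≤[ T ] (σ ⇒ (τ ∩ ρ))
  arr   : ∀ {T σ₁ σ₂ τ₁ τ₂} → HasArr T →
          σ₂ ≤[ T ] σ₁ → τ₁ ≤[ T ] τ₂ → (σ₁ ⇒ τ₁) ≤[ T ] (σ₂ ⇒ τ₂)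

_⊑ᵀ_ : Theory → Theory → Set
T₁ ⊑ᵀ T₂ = ∀ σ τ → σ ≤[ T₁ ] τ → σ ≤[ T₂ ] τ

-- Pure λ-terms (de Bruijn indices, so ≡ is identity up to α)

data Λ : Set where
  var : ℕ → Λ
  lam : Λ → Λ
  app : Λ → Λ → Λ

ext : (ℕ → ℕ) → ℕ → ℕ
ext ρ zero    = zero
ext ρ (suc n) = suc (ρ n)

rename : (ℕ → ℕ) → Λ → Λ
rename ρ (var n)   = var (ρ n)
rename ρ (lam M)   = lam (rename (ext ρ) M)
rename ρ (app M N) = app (rename ρ M) (rename ρ N)

exts : (ℕ → Λ) → ℕ → Λ
exts s zero    = var zero
exts s (suc n) = rename suc (s n)

subst : (ℕ → Λ) → Λ → Λ
subst s (var n)   = s n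
subst s (lam M)   = lam (subst (exts s) M)
subst s (app M N) = app (subst s M) (subst s N)

sub₀ : Λ → ℕ → Λ
sub₀ N zero    = N
sub₀ N (suc n) = var n

_[_] : Λ → Λ → Λ
M [ N ] = subst (sub₀ N) M

data Eta : Set where
  noη withη : Eta

data Conv : Eta → Λ → Λ → Set where
  β      : ∀ {e M N} → Conv e (app (lam M) N) (M [ N ])
  η      : ∀ {M} → Conv withη (lam (app (rename suc M) (var zero))) M
  refl   : ∀ {e M} → Conv e M M
  sym    : ∀ {e M N} → Conv e M N → Conv e N M
  trans  : ∀ {e M N P} → Conv e M N → Conv e N P → Conv e M P
  lamᶜ   : ∀ {e M N} → Conv e M N → Conv e (lam M) (lam N)
  appᶜ   : ∀ {e M M' N N'} → Conv e M M' → Conv e N N' →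
           Conv e (app M N) (app M' N')

data EqR : Set where
  syn beta betaeta : EqR

_∼[_]_ : Λ → EqR → Λ → Set
M ∼[ syn ]     N = M ≡ N
M ∼[ beta ]    N = Conv noη M N
M ∼[ betaeta ] N = Conv withη M N

_⊑ᴿ_ : EqR → EqR → Set
R₁ ⊑ᴿ R₂ = ∀ M N → M ∼[ R₁ ] N → M ∼[ R₂ ] N

data Δ : Set where
  u    : Δ → Δ
  var  : ℕ → Δ
  lam  : Type → Δ → Δ
  app  : Δ → Δ → Δ
  pair : Δ → Δ → Δ
  pr₁  : Δ → Δ
  pr₂  : Δ → Δ
  coe  : Δ → Type → Δ

⌊_⌋ : Δ → Λ
⌊ u d ⌋        = ⌊ d ⌋
⌊ var n ⌋      = var n
⌊ lam σ d ⌋    = lam ⌊ d ⌋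
⌊ app d e ⌋    = app ⌊ d ⌋ ⌊ e ⌋
⌊ pair d e ⌋   = ⌊ d ⌋
⌊ pr₁ d ⌋      = ⌊ d ⌋
⌊ pr₂ d ⌋      = ⌊ d ⌋
⌊ coe d σ ⌋    = ⌊ d ⌋

-- Bases (de Bruijn contexts: index 0 = most recent declaration)

Basis : Set
Basis = List Type

data _∋_∶_ : Basis → ℕ → Type → Set where
  here  : ∀ {Γ σ} → (σ ∷ Γ) ∋ zero ∶ σ
  there : ∀ {Γ τ n σ} → Γ ∋ n ∶ σ → (τ ∷ Γ) ∋ suc n ∶ σ

WFBasis : Theory → Basis → Set
WFBasis T Γ = All (Over T) Γ

data _⊢[_,_]_∶_ : Basis → Theory → EqR → Δ → Type → Set where
  top  : ∀ {Γ T R d} → HasΩ T → WFBasis T Γ → Γ ⊢[ T , R ] u d ∶ ω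
  ax   : ∀ {Γ T R n σ} → WFBasis T Γ → Γ ∋ n ∶ σ → Γ ⊢[ T , R ] var n ∶ σ
  →I   : ∀ {Γ T R σ τ d} → (σ ∷ Γ) ⊢[ T , R ] d ∶ τ →
         Γ ⊢[ T , R ] lam σ d ∶ (σ ⇒ τ)
  →E   : ∀ {Γ T R σ τ d e} → Γ ⊢[ T , R ] d ∶ (σ ⇒ τ) → Γ ⊢[ T , R ] e ∶ σ →
         Γ ⊢[ T , R ] app d e ∶ τ
  ∩I   : ∀ {Γ T R σ τ d e} → Γ ⊢[ T , R ] d ∶ σ → Γ ⊢[ T , R ] e ∶ τ →
         ⌊ d ⌋ ∼[ R ] ⌊ e ⌋ → Γ ⊢[ T , R ] pair d e ∶ (σ ∩ τ)
  ∩E₁  : ∀ {Γ T R σ τ d} → Γ ⊢[ T , R ] d ∶ (σ ∩ τ) → Γ ⊢[ T , R ] pr₁ d ∶ σ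
  ∩E₂  : ∀ {Γ T R σ τ d} → Γ ⊢[ T , R ] d ∶ (σ ∩ τ) → Γ ⊢[ T , R ] pr₂ d ∶ τ
  ≤T   : ∀ {Γ T R σ τ d} → Γ ⊢[ T , R ] d ∶ σ → σ ≤[ T ] τ →
         Γ ⊢[ T , R ] coe d τ ∶ τ

SysIncl : Theory → EqR → Theory → EqR → Set
SysIncl T₁ R₁ T₂ R₂ =
  ∀ Γ d σ → Γ ⊢[ T₁ , R₁ ] d ∶ σ → Γ ⊢[ T₂ , R₂ ] d ∶ σ

-- A derivation of Δ^𝒯₁_ℛ₁ is transported rule by rule into Δ^𝒯₂_ℛ₂: coercions
-- use 𝒯₁ ⊑ 𝒯₂, pairings use ℛ₁ ⊑ ℛ₂. The only hidden side conditions are that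
-- bases consist of types over the atom set, and that (top) needs ω to be an
-- atom; both are recovered from 𝒯₁ ⊑ 𝒯₂ applied to the reflexivity σ ≤ σ, since
-- inequations of a theory only relate types over its atom set. For part (1),
-- each of the four inclusions of theories holds because the larger theory has
-- the atoms and all the rules of the smaller one.
module Submission where

open import Defs
open import Data.Product using (_×_; _,_; proj₁; proj₂)
open import Data.Unit using (tt)
open import Data.List.Relation.Unary.All as All using ()

over-∩ : ∀ T {σ τ} → Over T σ → Over T τ → Over T (σ ∩ τ)
over-∩ CD  o o′ = o ∩ o′
over-∩ CDS _ _  = tt
over-∩ CDV o o′ = o ∩ o′
over-∩ BCD _ _  = tt

≤⇒over : ∀ {T σ τ} → σ ≤[ T ] τ → Over T σ × Over T τ
≤⇒over (refl o)               = o , o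
≤⇒over {T} (incl₁ o o′)       = over-∩ T o o′ , o
≤⇒over {T} (incl₂ o o′)       = over-∩ T o o′ , o′
≤⇒over {T} (glb p q)          = proj₁ (≤⇒over p) , over-∩ T (proj₂ (≤⇒over p)) (proj₂ (≤⇒over q))
≤⇒over (trans p q)            = proj₁ (≤⇒over p) , proj₂ (≤⇒over q)
≤⇒over (ω-top cds o)          = o , tt
≤⇒over (ω-top bcd o)          = o , tt
≤⇒over (ω-→ bcd _)            = tt , tt
≤⇒over (→∩ cdv oσ oτ oρ)      = (oσ ⇒ oτ) ∩ (oσ ⇒ oρ) , oσ ⇒ (oτ ∩ oρ)
≤⇒over (→∩ bcd _ _ _)         = tt , tt
≤⇒over (arr cdv p q)          = proj₂ (≤⇒over p) ⇒ proj₁ (≤⇒over q) , proj₁ (≤⇒over p) ⇒ proj₂ (≤⇒over q)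
≤⇒over (arr bcd _ _)          = tt , tt

over-mono : ∀ {T₁ T₂} → T₁ ⊑ᵀ T₂ → ∀ {σ} → Over T₁ σ → Over T₂ σ
over-mono T₁⊑T₂ {σ} o = proj₁ (≤⇒over (T₁⊑T₂ σ σ (refl o)))

hasΩ⇒over-ω : ∀ {T} → HasΩ T → Over T ω
hasΩ⇒over-ω cds = tt
hasΩ⇒over-ω bcd = tt

over-ω⇒hasΩ : ∀ T → Over T ω → HasΩ T
over-ω⇒hasΩ CDS _ = cds
over-ω⇒hasΩ BCD _ = bcd

hasΩ-mono : ∀ {T₁ T₂} → T₁ ⊑ᵀ T₂ → HasΩ T₁ → HasΩ T₂
hasΩ-mono {T₂ = T₂} T₁⊑T₂ h = over-ω⇒hasΩ T₂ (over-mono T₁⊑T₂ (hasΩ⇒over-ω h))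

⊢-mono : ∀ {T₁ T₂ R₁ R₂} → T₁ ⊑ᵀ T₂ → R₁ ⊑ᴿ R₂ → SysIncl T₁ R₁ T₂ R₂
⊢-mono {T₁} {T₂} {R₁} {R₂} T₁⊑T₂ R₁⊑R₂ = transport
  where
  basis : ∀ {Γ} → WFBasis T₁ Γ → WFBasis T₂ Γ
  basis = All.map (over-mono T₁⊑T₂)

  transport : SysIncl T₁ R₁ T₂ R₂
  transport _ _ _ (top h wf) = top (hasΩ-mono T₁⊑T₂ h) (basis wf)
  transport _ _ _ (ax wf x)  = ax (basis wf) x
  transport _ _ _ (→I p)     = →I (transport _ _ _ p)
  transport _ _ _ (→E p q)   = →E (transport _ _ _ p) (transport _ _ _ q)
  transport _ _ _ (∩I p q r) = ∩I (transport _ _ _ p) (transport _ _ _ q) (R₁⊑R₂ _ _ r)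
  transport _ _ _ (∩E₁ p)    = ∩E₁ (transport _ _ _ p)
  transport _ _ _ (∩E₂ p)    = ∩E₂ (transport _ _ _ p)
  transport _ _ _ (≤T p l)   = ≤T (transport _ _ _ p) (T₁⊑T₂ _ _ l)

record Extends (T₁ T₂ : Theory) : Set where
  field
    over    : ∀ {σ} → Over T₁ σ → Over T₂ σ
    hasΩ    : HasΩ T₁ → HasΩ T₂
    hasArr  : HasArr T₁ → HasArr T₂
    hasΩArr : HasΩArr T₁ → HasΩArr T₂

extends⇒⊑ᵀ : ∀ {T₁ T₂} → Extends T₁ T₂ → T₁ ⊑ᵀ T₂
extends⇒⊑ᵀ {T₁} {T₂} ext = embed
  where
  open Extends ext
  embed : T₁ ⊑ᵀ T₂
  embed _ _ (refl o)         = refl (over o)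
  embed _ _ (incl₁ o o′)     = incl₁ (over o) (over o′)
  embed _ _ (incl₂ o o′)     = incl₂ (over o) (over o′)
  embed _ _ (glb p q)        = glb (embed _ _ p) (embed _ _ q)
  embed _ _ (trans p q)      = trans (embed _ _ p) (embed _ _ q)
  embed _ _ (ω-top h o)      = ω-top (hasΩ h) (over o)
  embed _ _ (ω-→ h o)        = ω-→ (hasΩArr h) (over o)
  embed _ _ (→∩ h oσ oτ oρ)  = →∩ (hasArr h) (over oσ) (over oτ) (over oρ)
  embed _ _ (arr h p q)      = arr (hasArr h) (embed _ _ p) (embed _ _ q)

CD⊑CDS : CD ⊑ᵀ CDS
CD⊑CDS = extends⇒⊑ᵀ record
  { over = λ _ → tt ; hasΩ = λ () ; hasArr = λ () ; hasΩArr = λ () }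

CDS⊑BCD : CDS ⊑ᵀ BCD
CDS⊑BCD = extends⇒⊑ᵀ record
  { over = λ _ → tt ; hasΩ = λ _ → bcd ; hasArr = λ () ; hasΩArr = λ () }

CD⊑CDV : CD ⊑ᵀ CDV
CD⊑CDV = extends⇒⊑ᵀ record
  { over = λ o → o ; hasΩ = λ () ; hasArr = λ () ; hasΩArr = λ () }

CDV⊑BCD : CDV ⊑ᵀ BCD
CDV⊑BCD = extends⇒⊑ᵀ record
  { over = λ _ → tt ; hasΩ = λ () ; hasArr = λ _ → bcd ; hasΩArr = λ () }

⊑ᴿ-refl : ∀ R → R ⊑ᴿ R
⊑ᴿ-refl R _ _ M∼N = M∼N

lemma2p8 : ((R : EqR) →
               (SysIncl CD R CDS R × SysIncl CDS R BCD R)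
               × (SysIncl CD R CDV R × SysIncl CDV R BCD R))
             × ((T₁ T₂ : Theory) (R₁ R₂ : EqR) →
               T₁ ⊑ᵀ T₂ → R₁ ⊑ᴿ R₂ → SysIncl T₁ R₁ T₂ R₂)
lemma2p8 = chains , λ _ _ _ _ → ⊢-mono
  where
  chains : (R : EqR) →
             (SysIncl CD R CDS R × SysIncl CDS R BCD R)
             × (SysIncl CD R CDV R × SysIncl CDV R BCD R)
  chains R = (⊢-mono CD⊑CDS R⊑R , ⊢-mono CDS⊑BCD R⊑R)
           , (⊢-mono CD⊑CDV R⊑R , ⊢-mono CDV⊑BCD R⊑R)
    where
    R⊑R : R ⊑ᴿ R
    R⊑R = ⊑ᴿ-refl R
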